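{- If $n\ge m\ge 3$, then $\mu_{\rm o}(C_n\,\square\,C_m)\le 2m$.
   Context: $C_n$ is the cycle on $n$ vertices and $C_n\,\square\,C_m$ is the Cartesian product (torus graph). For a graph $G$ and $X\subseteq V(G)$, vertices $u,v\in V(G)$ are $X$-visible if there exists a shortest $u,v$-path $P$ with $V(P)\cap X\subseteq\{u,v\}$. $X$ is an outer mutual-visibility set if every two vertices of $X$ are $X$-visible and every $u\in X$, $v\in V(G)\setminus X$ are $X$-visible; $\mu_{\rm o}(G)$ is the maximum cardinality of an outer mutual-visibility set of $G$. -}

module Defs where

open import Level using (0ℓ)
open import Data.Nat using (ℕ; zero; suc; _+_; _≤_; _%_; NonZero)
open import Data.Fin using (Fin; toℕ)
open import Data.Product using (_×_; _,_; Σ; ∃)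
open import Data.Sum using (_⊎_)
open import Data.List using (List)
open import Data.List.Membership.Propositional using (_∈_)
open import Data.List.Relation.Unary.Unique.Propositional using (Unique)
open import Relation.Binary.PropositionalEquality using (_≡_)
open import Relation.Nullary using (¬_)
open import Data.Empty using (⊥)

record Graph : Set₁ where
  field
    V   : Set
    Adj : V → V → Set

module _ (G : Graph) where
  open Graph G

  data Walk : V → V → Set where
    [_]    : (u : V) → Walk u u
    _∷⟨_⟩_ : ∀ {w v} (u : V) → Adj u w → Walk w v → Walk u v

  walkLength : ∀ {u v} → Walk u v → ℕ
  walkLength [ u ] = 0
  walkLength (u ∷⟨ _ ⟩ p) = suc (walkLength p)

  data OnWalk (x : V) : ∀ {u v} → Walk u v → Set where
    here-end : OnWalk x [ x ]
    here     : ∀ {w v} {a : Adj x w} {p : Walk w v} → OnWalk x (x ∷⟨ a ⟩ p)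
    there    : ∀ {u w v} {a : Adj u w} {p : Walk w v} → OnWalk x p → OnWalk x (u ∷⟨ a ⟩ p)

  -- a shortest u,v-walk (necessarily a shortest u,v-path)
  IsShortest : ∀ {u v} → Walk u v → Set
  IsShortest {u} {v} p = (q : Walk u v) → walkLength p ≤ walkLength q

  Visible : List V → V → V → Set
  Visible X u v = Σ (Walk u v) λ P → IsShortest P ×
    (∀ x → OnWalk x P → x ∈ X → (x ≡ u ⊎ x ≡ v))

  IsOuterMV : List V → Set
  IsOuterMV X =
    (∀ u v → u ∈ X → v ∈ X → Visible X u v) ×
    (∀ u v → u ∈ X → ¬ (v ∈ X) → Visible X u v)

CycleAdj : (n : ℕ) → Fin n → Fin n → Set
CycleAdj zero i j = ⊥
CycleAdj (suc k) i j =
  toℕ j ≡ (toℕ i + 1) % suc k ⊎ toℕ i ≡ (toℕ j + 1) % suc k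

Torus : ℕ → ℕ → Graph
Torus n m = record
  { V   = Fin n × Fin m
  ; Adj = λ { (a , b) (c , d) →
        (CycleAdj n a c × b ≡ d) ⊎ (a ≡ c × CycleAdj m b d) } }

-- A row of C_n □ C_m is a copy of C_n; for n ≥ 4 it meets an outer mutual-visibility set X in at
-- most two vertices, which gives |X| ≤ 2m. Indeed, take three X-vertices on a row and k = ⌊n/2⌋.
-- The three gaps between them sum to n, so one of the three vertices, u, has its next X-vertex
-- on the row closer than k, and, when n = 2k, also its previous one. A shortest path from u to the
-- vertex k steps ahead of u has length k; a vertical step would cost two extra steps, so the path
-- is one of the arcs of the row of length k (the forward one, or when n = 2k also the backward one),
-- and either arc passes through an X-vertex. For n = m = 3 a row can hold three vertices of X, but
-- then no other row meets X: with (a , b), (a' , b), (a , b') in X, both shortest paths from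
-- (a , b) to (a' , b') are blocked. So rows have at most two vertices, or X is a single row.

{-# OPTIONS --safe #-}
module Submission where

open import Defs
open import Data.Bool using (true; false; if_then_else_)
open import Data.Empty using (⊥-elim)
open import Data.Fin using (Fin; zero; suc; toℕ; _≟_)
import Data.Fin as Fin
open import Data.Fin.Patterns using (0F; 1F; 2F)
open import Data.Fin.Properties using (toℕ<n; toℕ-injective; toℕ-fromℕ<; injective⇒≤)
import Data.Fin.Properties as Fin
open import Data.List using (List; []; _∷_; length; map; filter; lookup)
open import Data.List.Membership.Propositional using (_∈_)
open import Data.List.Membership.Propositional.Properties using (∈-lookup; ∈-map⁻; ∈-filter⁻)
import Data.List.Membership.DecPropositional as DecMembership
open import Data.List.Properties using (length-map)
open import Data.List.Relation.Unary.All as All using (All; []; _∷_)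
open import Data.List.Relation.Unary.All.Properties using (all-filter; ¬Any⇒All¬; map⁺)
open import Data.List.Relation.Unary.AllPairs using ([]; _∷_)
open import Data.List.Relation.Unary.Any using (here; there)
open import Data.List.Relation.Unary.Unique.Propositional using (Unique)
import Data.List.Relation.Unary.Unique.Propositional.Properties as Unique
open import Data.Nat
  using (ℕ; zero; suc; _+_; _*_; _∸_; _≤_; _<_; _≤?_; _<?_; z≤n; s≤s; s≤s⁻¹; z<s; NonZero; _%_)
open import Data.Nat.DivMod
  using (_mod_; %-distribˡ-+; m%n%n≡m%n; m<n⇒m%n≡m; m≤n⇒[n∸m]%m≡n%m; [m+n]%n≡m%n)
open import Data.Nat.Properties hiding (_≟_)
open import Algebra.Properties.CommutativeMonoid.Sum +-0-commutativeMonoid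
  using (sum-syntax; ∑-distrib-+; sum-cong-≗; sum-replicate-zero)
open import Data.Nat.Tactic.RingSolver using (solve-∀)
open import Data.Product using (Σ; _×_; _,_; proj₁; proj₂)
open import Data.Product.Properties using (≡-dec)
open import Data.Sum using (_⊎_; inj₁; inj₂; [_,_]′)
open import Function using (_∘_)
open import Relation.Binary.Definitions using (DecidableEquality; tri<; tri≈; tri>)
open import Relation.Binary.PropositionalEquality
open import Relation.Nullary using (¬_; Dec; yes; no; does; contradiction)

-- Visibility in an arbitrary graph

start-on-walk : ∀ {G u v} (P : Walk G u v) → OnWalk G u P
start-on-walk [ _ ] = here-end
start-on-walk (_ ∷⟨ _ ⟩ _) = here

module _ (G : Graph) where
  open Graph G

  HasInnerVertexIn : ∀ {u v} → List V → Walk G u v → Set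
  HasInnerVertexIn {u} {v} X P = Σ V λ w → OnWalk G w P × w ∈ X × w ≢ u × w ≢ v

  blocked⇒¬IsOuterMV : DecidableEquality V → ∀ {X u v} → u ∈ X → (Q : Walk G u v) →
    (∀ P → walkLength G P ≤ walkLength G Q → HasInnerVertexIn X P) → ¬ IsOuterMV G X
  blocked⇒¬IsOuterMV _≟V_ {X} {u} {v} u∈X Q blocked (between , outward) = invisible visible
    where
    open DecMembership _≟V_ using (_∈?_)
    visible : Visible G X u v
    visible with v ∈? X
    ... | yes v∈X = between u v u∈X v∈X
    ... | no v∉X = outward u v u∈X v∉X
    invisible : ¬ Visible G X u v
    invisible (P , shortest , clear) with blocked P (shortest Q)
    ... | w , w∈P , w∈X , w≢u , w≢v with clear w w∈P w∈X
    ... | inj₁ w≡u = w≢u w≡u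
    ... | inj₂ w≡v = w≢v w≡v

-- Counting points row by row

∑≤m*k : ∀ {m k} (f : Fin m → ℕ) → (∀ i → f i ≤ k) → ∑[ i < m ] f i ≤ m * k
∑≤m*k {zero} f f≤k = z≤n
∑≤m*k {suc m} f f≤k = +-mono-≤ (f≤k zero) (∑≤m*k (f ∘ suc) (f≤k ∘ suc))

δ : ∀ {m} → Fin m → Fin m → ℕ
δ c b = if does (c ≟ b) then 1 else 0

∑-δ : ∀ {m} (c : Fin m) → ∑[ b < m ] δ c b ≡ 1
∑-δ {suc m} zero = cong suc (sum-replicate-zero m)
∑-δ {suc m} (suc c) = ∑-δ c

module _ {A : Set} {m : ℕ} (key : A → Fin m) where

  fibre : Fin m → List A → List A
  fibre b = filter (λ x → key x ≟ b)

  length-fibre-∷ : ∀ b x xs → length (fibre b (x ∷ xs)) ≡ δ (key x) b + length (fibre b xs)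
  length-fibre-∷ b x xs with does (key x ≟ b)
  ... | true = refl
  ... | false = refl

  length≡∑-fibres : ∀ xs → length xs ≡ ∑[ b < m ] length (fibre b xs)
  length≡∑-fibres [] = sym (sum-replicate-zero m)
  length≡∑-fibres (x ∷ xs) = begin
    1 + length xs
      ≡⟨ cong₂ _+_ (sym (∑-δ (key x))) (length≡∑-fibres xs) ⟩
    ∑[ b < m ] δ (key x) b + ∑[ b < m ] length (fibre b xs)
      ≡⟨ ∑-distrib-+ (δ (key x)) (λ b → length (fibre b xs)) ⟨
    ∑[ b < m ] (δ (key x) b + length (fibre b xs))
      ≡⟨ sum-cong-≗ (λ b → length-fibre-∷ b x xs) ⟨
    ∑[ b < m ] length (fibre b (x ∷ xs))
      ∎
    where open ≡-Reasoning

lookup-injective : ∀ {A : Set} {xs : List A} → Unique xs → ∀ i j → lookup xs i ≡ lookup xs j → i ≡ j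
lookup-injective (x≢xs ∷ _) zero zero _ = refl
lookup-injective (x≢xs ∷ _) zero (suc j) eq = contradiction eq (All.lookup x≢xs (∈-lookup j))
lookup-injective (x≢xs ∷ _) (suc i) zero eq = contradiction (sym eq) (All.lookup x≢xs (∈-lookup i))
lookup-injective (_ ∷ u) (suc i) (suc j) eq = cong suc (lookup-injective u i j eq)

module _ {k : ℕ} where
  open DecMembership (_≟_ {k}) using (_∈?_)

  Unique⇒length≤ : ∀ {xs : List (Fin k)} → Unique xs → length xs ≤ k
  Unique⇒length≤ u = injective⇒≤ (lookup-injective u _ _)

  Unique∧k≤length⇒∈ : ∀ {xs : List (Fin k)} → Unique xs → k ≤ length xs → ∀ a → a ∈ xs
  Unique∧k≤length⇒∈ {xs} u k≤length a with a ∈? xs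
  ... | yes a∈xs = a∈xs
  ... | no a∉xs = contradiction (Unique⇒length≤ (¬Any⇒All¬ xs a∉xs ∷ u)) (<⇒≱ (s≤s k≤length))

module _ {A : Set} {m : ℕ} where

  columns : List (A × Fin m) → Fin m → List A
  columns X b = map proj₁ (fibre proj₂ b X)

  length≡∑-columns : ∀ X → length X ≡ ∑[ b < m ] length (columns X b)
  length≡∑-columns X =
    trans (length≡∑-fibres proj₂ X) (sum-cong-≗ (λ b → sym (length-map proj₁ (fibre proj₂ b X))))

  ∈-columns⁻ : ∀ {X a b} → a ∈ columns X b → (a , b) ∈ X
  ∈-columns⁻ {X} {b = b} a∈columns with ∈-map⁻ proj₁ a∈columns
  ... | v , v∈fibre , refl with ∈-filter⁻ (λ x → proj₂ x ≟ b) {xs = X} v∈fibre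
  ... | v∈X , refl = v∈X

  Unique-columns : ∀ {X} b → Unique X → Unique (columns X b)
  Unique-columns {X} b u =
    projection (Unique.filter⁺ (λ x → proj₂ x ≟ b) u) (all-filter (λ x → proj₂ x ≟ b) X)
    where
    projection : ∀ {L} → Unique L → All (λ v → proj₂ v ≡ b) L → Unique (map proj₁ L)
    projection [] [] = []
    projection (v≢L ∷ u) (v-in-b ∷ in-b) =
      map⁺ (All.zipWith (λ (v≢w , w-in-b) eq → v≢w (cong₂ _,_ eq (trans v-in-b (sym w-in-b))))
                        (v≢L , in-b))
      ∷ projection u in-b

-- Arithmetic on the cycle

module _ {n : ℕ} .{{_ : NonZero n}} where

  [m%n+o]%n≡[m+o]%n : ∀ m o → (m % n + o) % n ≡ (m + o) % n
  [m%n+o]%n≡[m+o]%n m o = begin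
    (m % n + o) % n          ≡⟨ %-distribˡ-+ (m % n) o n ⟩
    (m % n % n + o % n) % n  ≡⟨ cong (λ r → (r + o % n) % n) (m%n%n≡m%n m n) ⟩
    (m % n + o % n) % n      ≡⟨ %-distribˡ-+ m o n ⟨
    (m + o) % n              ∎
    where open ≡-Reasoning

  [r+d]%n≡r⇒d≡0⊎d≡n : ∀ {r d} → r < n → d ≤ n → (r + d) % n ≡ r → d ≡ 0 ⊎ d ≡ n
  [r+d]%n≡r⇒d≡0⊎d≡n {r} {d} r<n d≤n eq with r + d <? n
  ... | yes r+d<n = inj₁ (+-cancelˡ-≡ r d 0 (begin
    r + d        ≡⟨ m<n⇒m%n≡m r+d<n ⟨
    (r + d) % n  ≡⟨ eq ⟩
    r            ≡⟨ +-identityʳ r ⟨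
    r + 0        ∎))
    where open ≡-Reasoning
  ... | no r+d≮n = inj₂ (+-cancelˡ-≡ r d n (begin
    r + d            ≡⟨ m∸n+n≡m n≤r+d ⟨
    r + d ∸ n + n    ≡⟨ cong (_+ n) wrapped ⟩
    r + n            ∎))
    where
    open ≡-Reasoning
    n≤r+d = ≮⇒≥ r+d≮n
    wrapped : r + d ∸ n ≡ r
    wrapped = begin
      r + d ∸ n        ≡⟨ m<n⇒m%n≡m (m<n+o⇒m∸n<o (r + d) n (+-mono-<-≤ r<n d≤n)) ⟨
      (r + d ∸ n) % n  ≡⟨ m≤n⇒[n∸m]%m≡n%m n≤r+d ⟩
      (r + d) % n      ≡⟨ eq ⟩
      r                ∎

  next : Fin n → Fin n
  next c = (toℕ c + 1) mod n

  infixl 6 _⊕_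
  _⊕_ : Fin n → ℕ → Fin n
  c ⊕ zero = c
  c ⊕ suc j = next c ⊕ j

  toℕ-⊕ : ∀ c j → toℕ (c ⊕ j) ≡ (toℕ c + j) % n
  toℕ-⊕ c zero = sym (trans (cong (_% n) (+-identityʳ (toℕ c))) (m<n⇒m%n≡m (toℕ<n c)))
  toℕ-⊕ c (suc j) = begin
    toℕ (next c ⊕ j)           ≡⟨ toℕ-⊕ (next c) j ⟩
    (toℕ (next c) + j) % n     ≡⟨ cong (λ r → (r + j) % n) (toℕ-fromℕ< _) ⟩
    ((toℕ c + 1) % n + j) % n  ≡⟨ [m%n+o]%n≡[m+o]%n (toℕ c + 1) j ⟩
    (toℕ c + 1 + j) % n        ≡⟨ cong (_% n) (+-assoc (toℕ c) 1 j) ⟩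
    (toℕ c + suc j) % n        ∎
    where open ≡-Reasoning

  ⊕-+ : ∀ c i j → c ⊕ (i + j) ≡ c ⊕ i ⊕ j
  ⊕-+ c zero j = refl
  ⊕-+ c (suc i) j = ⊕-+ (next c) i j

  ⊕-suc : ∀ c j → c ⊕ suc j ≡ next (c ⊕ j)
  ⊕-suc c j = trans (cong (c ⊕_) (+-comm 1 j)) (⊕-+ c j 1)

  ⊕-comm : ∀ c i j → c ⊕ i ⊕ j ≡ c ⊕ j ⊕ i
  ⊕-comm c i j = trans (sym (⊕-+ c i j)) (trans (cong (c ⊕_) (+-comm i j)) (⊕-+ c j i))

  ⊕-reaches : ∀ c e {d} → (toℕ c + e) % n ≡ toℕ d → c ⊕ e ≡ d
  ⊕-reaches c e eq = toℕ-injective (trans (toℕ-⊕ c e) eq)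

  ⊕-reaches-< : ∀ c e {d} → toℕ c + e ≡ toℕ d → c ⊕ e ≡ d
  ⊕-reaches-< c e {d} eq = ⊕-reaches c e (trans (cong (_% n) eq) (m<n⇒m%n≡m (toℕ<n d)))

  ⊕-fixed : ∀ {c d} → d ≤ n → c ⊕ d ≡ c → d ≡ 0 ⊎ d ≡ n
  ⊕-fixed {c} {d} d≤n eq =
    [r+d]%n≡r⇒d≡0⊎d≡n (toℕ<n c) d≤n (trans (sym (toℕ-⊕ c d)) (cong toℕ eq))

  ⊕-≢ : ∀ c {d} → 0 < d → d < n → c ⊕ d ≢ c
  ⊕-≢ c 0<d d<n eq with ⊕-fixed (<⇒≤ d<n) eq
  ... | inj₁ refl = <-irrefl refl 0<d
  ... | inj₂ refl = <-irrefl refl d<n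

  ⊕-≢-⊕ : ∀ c {i j} → i < j → j < n → c ⊕ i ≢ c ⊕ j
  ⊕-≢-⊕ c {i} {j} i<j j<n eq = ⊕-≢ (c ⊕ i) (m<n⇒0<n∸m i<j) (≤-<-trans (m∸n≤m j i) j<n) (begin
    c ⊕ i ⊕ (j ∸ i)    ≡⟨ ⊕-+ c i (j ∸ i) ⟨
    c ⊕ (i + (j ∸ i))  ≡⟨ cong (c ⊕_) (m+[n∸m]≡n (<⇒≤ i<j)) ⟩
    c ⊕ j              ≡⟨ eq ⟨
    c ⊕ i              ∎)
    where open ≡-Reasoning

  ⊕-injective-≤ : ∀ {c d} j → toℕ c ≤ toℕ d → c ⊕ j ≡ d ⊕ j → c ≡ d
  ⊕-injective-≤ {c} {d} j c≤d eq =
    [ (λ e≡0 → trans (cong (c ⊕_) (sym e≡0)) c⊕e≡d) , (λ e≡n → contradiction e≡n (<⇒≢ e<n)) ]′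
      (⊕-fixed (<⇒≤ e<n) shifted)
    where
    e = toℕ d ∸ toℕ c
    e<n : e < n
    e<n = ≤-<-trans (m∸n≤m (toℕ d) (toℕ c)) (toℕ<n d)
    c⊕e≡d : c ⊕ e ≡ d
    c⊕e≡d = ⊕-reaches-< c e (m+[n∸m]≡n c≤d)
    shifted : c ⊕ j ⊕ e ≡ c ⊕ j
    shifted = trans (⊕-comm c j e) (trans (cong (_⊕ j) c⊕e≡d) (sym eq))

  ⊕-injective : ∀ {c d} j → c ⊕ j ≡ d ⊕ j → c ≡ d
  ⊕-injective {c} {d} j eq with ≤-total (toℕ c) (toℕ d)
  ... | inj₁ c≤d = ⊕-injective-≤ j c≤d eq
  ... | inj₂ d≤c = sym (⊕-injective-≤ j d≤c (sym eq))

m+m≤n+n⇒m≤n : ∀ {m n} → m + m ≤ n + n → m ≤ n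
m+m≤n+n⇒m≤n le = ≮⇒≥ (λ n<m → <⇒≱ (+-mono-< n<m n<m) le)

-- F, B, H count the forward, backward and vertical steps of a walk of length ≤ k = F + s ≤ N / 2
-- ending k steps ahead, so that s + B ≡ 0 (mod N): it goes straight forward, or N = 2k and it goes
-- straight backward.
short-walk-counts : ∀ {N F B H s} → F + B + H ≤ F + s → (F + s) + (F + s) ≤ N →
  s + B ≡ 0 ⊎ s + B ≡ N → (s ≡ 0 × B ≡ 0 × H ≡ 0) ⊎ (F ≡ 0 × B ≡ s × H ≡ 0 × s + s ≡ N)
short-walk-counts {F = F} {zero} {H} {zero} steps≤ _ (inj₁ refl) =
  inj₁ (refl , refl , n≤0⇒n≡0 (+-cancelˡ-≤ F H 0 (subst (_≤ F + 0) (cong (_+ H) (+-identityʳ F)) steps≤)))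
short-walk-counts {B = suc _} {s = zero} _ _ (inj₁ ())
short-walk-counts {s = suc _} _ _ (inj₁ ())
short-walk-counts {N} {F} {B} {H} {s} steps≤ k+k≤N (inj₂ s+B≡N) =
  inj₂ (F≡0 , B≡s , H≡0 , trans (cong (s +_) (sym B≡s)) s+B≡N)
  where
  B+H≤s : B + H ≤ s
  B+H≤s = +-cancelˡ-≤ F (B + H) s (subst (_≤ F + s) (+-assoc F B H) steps≤)
  B≤s : B ≤ s
  B≤s = m+n≤o⇒m≤o B B+H≤s
  F≡0 : F ≡ 0
  F≡0 = n≤0⇒n≡0 (+-cancelʳ-≤ s F 0 (m+m≤n+n⇒m≤n (≤-trans k+k≤N (subst (_≤ s + s) s+B≡N (+-monoʳ-≤ s B≤s)))))
  s≤B : s ≤ B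
  s≤B = +-cancelˡ-≤ s s B
    (subst (λ f → (f + s) + (f + s) ≤ s + B) F≡0 (subst (_ ≤_) (sym s+B≡N) k+k≤N))
  B≡s : B ≡ s
  B≡s = ≤-antisym B≤s s≤B
  H≡0 : H ≡ 0
  H≡0 = n≤0⇒n≡0 (+-cancelˡ-≤ B H 0 (subst (B + H ≤_) (trans (sym B≡s) (sym (+-identityʳ B))) B+H≤s))

halving : ∀ N → Σ ℕ λ k → k + k ≤ N × N ≤ suc (k + k)
halving zero = 0 , z≤n , z≤n
halving (suc zero) = 0 , z≤n , s≤s z≤n
halving (suc (suc N)) with halving N
... | k , k+k≤N , N≤1+k+k =
  suc k , s≤s (subst (_≤ suc N) (sym (+-suc k k)) (s≤s k+k≤N))
        , s≤s (s≤s (subst (N ≤_) (sym (+-suc k k)) N≤1+k+k))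

-- A point whose next point on the cycle is less than k away and, when the vertex k ahead can also
-- be reached backwards (N = 2k), so is its previous point.
Blocking : (N k next previous : ℕ) → Set
Blocking N k next previous = next < k × (k + k ≡ N → previous < k)

three-gaps-blocking : ∀ {N g₁ g₂ g₃} → 0 < g₁ → 0 < g₂ → 0 < g₃ → g₁ + g₂ + g₃ ≡ N → 4 ≤ N →
  Σ ℕ λ k → k + k ≤ N × (Blocking N k g₁ g₃ ⊎ Blocking N k g₂ g₁ ⊎ Blocking N k g₃ g₂)
three-gaps-blocking {N} {g₁} {g₂} {g₃} 0<g₁ 0<g₂ 0<g₃ gaps≡N 4≤N with halving N
... | k , k+k≤N , N≤1+k+k = k , k+k≤N , choose (g₁ <? k) (g₂ <? k) (g₃ <? k)
  where
  lower : ∀ {x y z} → x ≤ g₁ → y ≤ g₂ → z ≤ g₃ → x + y + z ≤ N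
  lower x≤g₁ y≤g₂ z≤g₃ = subst (_ ≤_) gaps≡N (+-mono-≤ (+-mono-≤ x≤g₁ y≤g₂) z≤g₃)
  choose : Dec (g₁ < k) → Dec (g₂ < k) → Dec (g₃ < k) →
    Blocking N k g₁ g₃ ⊎ Blocking N k g₂ g₁ ⊎ Blocking N k g₃ g₂
  choose (yes g₁<k) _ (yes g₃<k) = inj₁ (g₁<k , λ _ → g₃<k)
  choose (yes g₁<k) (yes g₂<k) (no _) = inj₂ (inj₁ (g₂<k , λ _ → g₁<k))
  choose (no _) (yes g₂<k) (yes g₃<k) = inj₂ (inj₂ (g₃<k , λ _ → g₂<k))
  choose (yes g₁<k) (no g₂≮k) (no g₃≮k) =
    inj₁ (g₁<k , λ even → ⊥-elim (<-irrefl even (lower 0<g₁ (≮⇒≥ g₂≮k) (≮⇒≥ g₃≮k))))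
  choose (no g₁≮k) (yes g₂<k) (no g₃≮k) =
    inj₂ (inj₁ (g₂<k , λ even → ⊥-elim (<-irrefl even
      (subst (_≤ N) (cong (_+ k) (+-comm k 1)) (lower (≮⇒≥ g₁≮k) 0<g₂ (≮⇒≥ g₃≮k))))))
  choose (no g₁≮k) (no g₂≮k) (yes g₃<k) =
    inj₂ (inj₂ (g₃<k , λ even → ⊥-elim (<-irrefl even
      (subst (_≤ N) (+-comm (k + k) 1) (lower (≮⇒≥ g₁≮k) (≮⇒≥ g₂≮k) 0<g₃)))))
  choose (no g₁≮k) (no g₂≮k) (no g₃≮k) = ⊥-elim (<⇒≱ (n<1+n 3) 4≤3)
    where
    k≤1 : k ≤ 1
    k≤1 = +-cancelˡ-≤ (k + k) k 1
      (≤-trans (lower (≮⇒≥ g₁≮k) (≮⇒≥ g₂≮k) (≮⇒≥ g₃≮k)) (subst (N ≤_) (+-comm 1 (k + k)) N≤1+k+k))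
    4≤3 : 4 ≤ 3
    4≤3 = ≤-trans 4≤N (≤-trans N≤1+k+k (s≤s (+-mono-≤ k≤1 k≤1)))

-- Walks in the torus

module _ {n m : ℕ} where

  private
    G = Torus (suc n) m

  data Move : Fin (suc n) → Fin (suc n) → Set where
    forward  : ∀ {a} → Move a (next a)
    backward : ∀ {c} → Move (next c) c

  data Step : Graph.V G → Graph.V G → Set where
    horizontal : ∀ {a c b} → Move a c → Step (a , b) (c , b)
    vertical   : ∀ {a b d} → Step (a , b) (a , d)

  step : ∀ {u w} → Graph.Adj G u w → Step u w
  step {a , b} (inj₁ (inj₁ c≡a+1 , refl)) =
    subst (λ c → Step (a , b) (c , b)) (⊕-reaches a 1 (sym c≡a+1)) (horizontal forward)
  step {_} {c , b} (inj₁ (inj₂ a≡c+1 , refl)) =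
    subst (λ a → Step (a , b) (c , b)) (⊕-reaches c 1 (sym a≡c+1)) (horizontal backward)
  step (inj₂ (refl , _)) = vertical

  forwardSteps backwardSteps verticalSteps : ∀ {u v} → Walk G u v → ℕ
  forwardSteps [ _ ] = 0
  forwardSteps (_ ∷⟨ s ⟩ p) with step s
  ... | horizontal forward = suc (forwardSteps p)
  ... | horizontal backward = forwardSteps p
  ... | vertical = forwardSteps p
  backwardSteps [ _ ] = 0
  backwardSteps (_ ∷⟨ s ⟩ p) with step s
  ... | horizontal forward = backwardSteps p
  ... | horizontal backward = suc (backwardSteps p)
  ... | vertical = backwardSteps p
  verticalSteps [ _ ] = 0
  verticalSteps (_ ∷⟨ s ⟩ p) with step s
  ... | horizontal _ = verticalSteps p
  ... | vertical = suc (verticalSteps p)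

  steps-sum : ∀ {u v} (P : Walk G u v) →
    forwardSteps P + backwardSteps P + verticalSteps P ≡ walkLength G P
  steps-sum [ _ ] = refl
  steps-sum (_ ∷⟨ s ⟩ p) with step s
  ... | horizontal forward = cong suc (steps-sum p)
  ... | horizontal backward =
    trans (cong (_+ verticalSteps p) (+-suc (forwardSteps p) (backwardSteps p))) (cong suc (steps-sum p))
  ... | vertical =
    trans (+-suc (forwardSteps p + backwardSteps p) (verticalSteps p)) (cong suc (steps-sum p))

  displacement : ∀ {a b c d} (P : Walk G (a , b) (c , d)) → c ⊕ backwardSteps P ≡ a ⊕ forwardSteps P
  displacement [ _ ] = refl
  displacement {c = c} (_ ∷⟨ s ⟩ p) with step s
  ... | horizontal forward = displacement p
  ... | horizontal (backward {a}) = begin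
    c ⊕ suc (backwardSteps p)   ≡⟨ ⊕-suc c (backwardSteps p) ⟩
    next (c ⊕ backwardSteps p)  ≡⟨ cong next (displacement p) ⟩
    next (a ⊕ forwardSteps p)   ≡⟨ ⊕-suc a (forwardSteps p) ⟨
    next a ⊕ forwardSteps p     ∎
    where open ≡-Reasoning
  ... | vertical = displacement p

  IsForward IsBackward : ∀ {u v} → Walk G u v → Set
  IsForward P = backwardSteps P ≡ 0 × verticalSteps P ≡ 0
  IsBackward P = forwardSteps P ≡ 0 × verticalSteps P ≡ 0

  forward-visits : ∀ {a b v} (P : Walk G (a , b) v) → IsForward P →
    ∀ {j} → j ≤ forwardSteps P → OnWalk G (a ⊕ j , b) P
  forward-visits P _ {zero} _ = start-on-walk P
  forward-visits (_ ∷⟨ s ⟩ p) straight {suc j} j≤F with step s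
  ... | horizontal forward = there (forward-visits p straight (s≤s⁻¹ j≤F))
  ... | horizontal backward = contradiction (proj₁ straight) λ ()
  ... | vertical = contradiction (proj₂ straight) λ ()

  backward-visits : ∀ {a b v} (P : Walk G (a , b) v) → IsBackward P →
    ∀ {x j} → j ≤ backwardSteps P → x ⊕ j ≡ a → OnWalk G (x , b) P
  backward-visits P _ {j = zero} _ refl = start-on-walk P
  backward-visits (_ ∷⟨ s ⟩ p) straight {x} {suc j} j≤B x⊕j≡a with step s
  ... | horizontal forward = contradiction (proj₁ straight) λ ()
  ... | horizontal backward =
    there (backward-visits p straight (s≤s⁻¹ j≤B) (⊕-injective 1 (trans (sym (⊕-suc x j)) x⊕j≡a)))
  ... | vertical = contradiction (proj₂ straight) λ ()

  forward-walk : ∀ a b k → Walk G (a , b) (a ⊕ k , b)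
  forward-walk a b zero = [ (a , b) ]
  forward-walk a b (suc k) = (a , b) ∷⟨ inj₁ (inj₁ (toℕ-fromℕ< _) , refl) ⟩ forward-walk (next a) b k

  walkLength-forward-walk : ∀ a b k → walkLength G (forward-walk a b k) ≡ k
  walkLength-forward-walk a b zero = refl
  walkLength-forward-walk a b (suc k) = cong suc (walkLength-forward-walk (next a) b k)

  short-walk-straight : ∀ {k a b c d} (P : Walk G (a , b) (c , d)) → k + k ≤ suc n →
    walkLength G P ≤ k → c ≡ a ⊕ k →
    (IsForward P × forwardSteps P ≡ k) ⊎ (k + k ≡ suc n × IsBackward P × backwardSteps P ≡ k)
  short-walk-straight {k} {a} {c = c} P k+k≤N length≤k c≡a⊕k =
    straighten (short-walk-counts (subst (F + B + H ≤_) (sym F+s≡k) steps≤k)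
                                  (subst (λ t → t + t ≤ suc n) (sym F+s≡k) k+k≤N)
                                  (⊕-fixed s+B≤N returns))
    where
    F = forwardSteps P
    B = backwardSteps P
    H = verticalSteps P
    steps≤k : F + B + H ≤ k
    steps≤k = subst (_≤ k) (sym (steps-sum P)) length≤k
    F+B≤k : F + B ≤ k
    F+B≤k = m+n≤o⇒m≤o (F + B) steps≤k
    s = k ∸ F
    F+s≡k : F + s ≡ k
    F+s≡k = m+[n∸m]≡n (m+n≤o⇒m≤o F F+B≤k)
    s+B≤N : s + B ≤ suc n
    s+B≤N = ≤-trans (+-mono-≤ (m∸n≤m k F) (m+n≤o⇒n≤o F F+B≤k)) k+k≤N
    returns : a ⊕ F ⊕ (s + B) ≡ a ⊕ F
    returns = begin
      a ⊕ F ⊕ (s + B)    ≡⟨ ⊕-+ a F (s + B) ⟨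
      a ⊕ (F + (s + B))  ≡⟨ cong (a ⊕_) (+-assoc F s B) ⟨
      a ⊕ (F + s + B)    ≡⟨ ⊕-+ a (F + s) B ⟩
      a ⊕ (F + s) ⊕ B    ≡⟨ cong (λ t → a ⊕ t ⊕ B) F+s≡k ⟩
      a ⊕ k ⊕ B          ≡⟨ cong (_⊕ B) c≡a⊕k ⟨
      c ⊕ B              ≡⟨ displacement P ⟩
      a ⊕ F              ∎
      where open ≡-Reasoning
    straighten : (s ≡ 0 × B ≡ 0 × H ≡ 0) ⊎ (F ≡ 0 × B ≡ s × H ≡ 0 × s + s ≡ suc n) →
      (IsForward P × F ≡ k) ⊎ (k + k ≡ suc n × IsBackward P × B ≡ k)
    straighten (inj₁ (s≡0 , B≡0 , H≡0)) =
      inj₁ ((B≡0 , H≡0) , trans (sym (+-identityʳ F)) (trans (cong (F +_) (sym s≡0)) F+s≡k))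
    straighten (inj₂ (F≡0 , B≡s , H≡0 , s+s≡N)) =
      inj₂ (trans (cong₂ _+_ (sym s≡k) (sym s≡k)) s+s≡N , (F≡0 , H≡0) , trans B≡s s≡k)
      where
      s≡k : s ≡ k
      s≡k = trans (cong (_+ s) (sym F≡0)) F+s≡k

  diagonal-walk-corner : ∀ {a b c d} (P : Walk G (a , b) (c , d)) → walkLength G P ≤ 2 →
    a ≢ c → b ≢ d → OnWalk G (c , b) P ⊎ OnWalk G (a , d) P
  diagonal-walk-corner [ _ ] _ a≢c _ = contradiction refl a≢c
  diagonal-walk-corner (_ ∷⟨ s ⟩ [ _ ]) _ a≢c b≢d with step s
  ... | horizontal _ = contradiction refl b≢d
  ... | vertical = contradiction refl a≢c
  diagonal-walk-corner (_ ∷⟨ s ⟩ (_ ∷⟨ t ⟩ [ _ ])) _ a≢c b≢d with step s | step t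
  ... | horizontal _ | horizontal _ = contradiction refl b≢d
  ... | horizontal _ | vertical = inj₁ (there here)
  ... | vertical | horizontal _ = inj₂ (there here)
  ... | vertical | vertical = contradiction refl a≢c
  diagonal-walk-corner (_ ∷⟨ _ ⟩ (_ ∷⟨ _ ⟩ (_ ∷⟨ _ ⟩ _))) (s≤s (s≤s ()))

  private
    _≟V_ : DecidableEquality (Graph.V G)
    _≟V_ = ≡-dec _≟_ _≟_

  corner⇒¬IsOuterMV : ∀ {X a b c d} → CycleAdj (suc n) a c → CycleAdj m b d → a ≢ c → b ≢ d →
    (a , b) ∈ X → (c , b) ∈ X → (a , d) ∈ X → ¬ IsOuterMV G X
  corner⇒¬IsOuterMV {X} {a} {b} {c} {d} a~c b~d a≢c b≢d ab∈X cb∈X ad∈X =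
    blocked⇒¬IsOuterMV G _≟V_ ab∈X
      ((a , b) ∷⟨ inj₁ (a~c , refl) ⟩ ((c , b) ∷⟨ inj₂ (refl , b~d) ⟩ [ (c , d) ])) inner
    where
    inner : ∀ P → walkLength G P ≤ 2 → HasInnerVertexIn G X P
    inner P length≤2 with diagonal-walk-corner P length≤2 a≢c b≢d
    ... | inj₁ on = (c , b) , on , cb∈X , (a≢c ∘ sym ∘ cong proj₁) , (b≢d ∘ cong proj₂)
    ... | inj₂ on = (a , d) , on , ad∈X , (b≢d ∘ sym ∘ cong proj₂) , (a≢c ∘ cong proj₁)

  close-neighbours⇒¬IsOuterMV : ∀ {X k b w u v j₀ j₁} → k + k ≤ suc n →
    (w , b) ∈ X → (u , b) ∈ X → (v , b) ∈ X → w ⊕ j₀ ≡ u → u ⊕ j₁ ≡ v →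
    0 < j₀ → 0 < j₁ → Blocking (suc n) k j₁ j₀ → ¬ IsOuterMV G X
  close-neighbours⇒¬IsOuterMV {X} {k} {b} {w} {u} {v} {j₀} {j₁}
    k+k≤N w∈X u∈X v∈X w⊕j₀≡u u⊕j₁≡v 0<j₀ 0<j₁ (j₁<k , even⇒j₀<k) =
    blocked⇒¬IsOuterMV G _≟V_ u∈X (forward-walk u b k) inner
    where
    k<N : k < suc n
    k<N = <-≤-trans (m<m+n k (<-trans 0<j₁ j₁<k)) k+k≤N
    v≢u : v ≢ u
    v≢u v≡u = ⊕-≢-⊕ u 0<j₁ (<-trans j₁<k k<N) (sym (trans u⊕j₁≡v v≡u))
    v≢u⊕k : v ≢ u ⊕ k
    v≢u⊕k v≡u⊕k = ⊕-≢-⊕ u j₁<k k<N (trans u⊕j₁≡v v≡u⊕k)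
    module Antipodal (k+k≡N : k + k ≡ suc n) where
      j₀<k : j₀ < k
      j₀<k = even⇒j₀<k k+k≡N
      w≢u : w ≢ u
      w≢u w≡u = ⊕-≢-⊕ w 0<j₀ (<-trans j₀<k k<N) (trans w≡u (sym w⊕j₀≡u))
      w≢u⊕k : w ≢ u ⊕ k
      w≢u⊕k w≡u⊕k = ⊕-≢-⊕ w (<-≤-trans 0<j₀ (m≤m+n j₀ k)) (subst (j₀ + k <_) k+k≡N (+-monoˡ-< k j₀<k))
        (trans w≡u⊕k (trans (cong (_⊕ k) (sym w⊕j₀≡u)) (sym (⊕-+ w j₀ k))))
    inner : ∀ P → walkLength G P ≤ walkLength G (forward-walk u b k) → HasInnerVertexIn G X P
    inner P length≤
      with short-walk-straight P k+k≤N (subst (walkLength G P ≤_) (walkLength-forward-walk u b k) length≤) refl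
    ... | inj₁ (straight , F≡k) =
      (v , b) , subst (λ x → OnWalk G (x , b) P) u⊕j₁≡v
                  (forward-visits P straight (subst (j₁ ≤_) (sym F≡k) (<⇒≤ j₁<k)))
              , v∈X , v≢u ∘ cong proj₁ , v≢u⊕k ∘ cong proj₁
    ... | inj₂ (k+k≡N , straight , B≡k) =
      (w , b) , backward-visits P straight (subst (j₀ ≤_) (sym B≡k) (<⇒≤ j₀<k)) w⊕j₀≡u
              , w∈X , w≢u ∘ cong proj₁ , w≢u⊕k ∘ cong proj₁
      where open Antipodal k+k≡N

  cyclic-triple⇒¬IsOuterMV : ∀ {X b x y z g₁ g₂ g₃} → 3 ≤ n →
    (x , b) ∈ X → (y , b) ∈ X → (z , b) ∈ X → x ⊕ g₁ ≡ y → y ⊕ g₂ ≡ z → z ⊕ g₃ ≡ x →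
    0 < g₁ → 0 < g₂ → 0 < g₃ → g₁ + g₂ + g₃ ≡ suc n → ¬ IsOuterMV G X
  cyclic-triple⇒¬IsOuterMV 3≤n x∈X y∈X z∈X x→y y→z z→x 0<g₁ 0<g₂ 0<g₃ gaps
    with three-gaps-blocking 0<g₁ 0<g₂ 0<g₃ gaps (s≤s 3≤n)
  ... | k , k+k≤N , inj₁ at-x =
    close-neighbours⇒¬IsOuterMV k+k≤N z∈X x∈X y∈X z→x x→y 0<g₃ 0<g₁ at-x
  ... | k , k+k≤N , inj₂ (inj₁ at-y) =
    close-neighbours⇒¬IsOuterMV k+k≤N x∈X y∈X z∈X x→y y→z 0<g₁ 0<g₂ at-y
  ... | k , k+k≤N , inj₂ (inj₂ at-z) =
    close-neighbours⇒¬IsOuterMV k+k≤N y∈X z∈X x∈X y→z z→x 0<g₂ 0<g₃ at-z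

  sorted-triple⇒¬IsOuterMV : ∀ {X b x y z} → 3 ≤ n → x Fin.< y → y Fin.< z →
    (x , b) ∈ X → (y , b) ∈ X → (z , b) ∈ X → ¬ IsOuterMV G X
  sorted-triple⇒¬IsOuterMV {x = x} {y} {z} 3≤n x<y y<z x∈X y∈X z∈X
    with m≤n⇒∃[o]m+o≡n x<y | m≤n⇒∃[o]m+o≡n y<z | m≤n⇒∃[o]m+o≡n (toℕ<n z)
  ... | o₁ , x+g₁≡y | o₂ , y+g₂≡z | o₃ , z+o₃≡N =
    cyclic-triple⇒¬IsOuterMV 3≤n x∈X y∈X z∈X
      (⊕-reaches-< x (suc o₁) (trans (+-suc (toℕ x) o₁) x+g₁≡y))
      (⊕-reaches-< y (suc o₂) (trans (+-suc (toℕ y) o₂) y+g₂≡z))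
      (⊕-reaches z (suc o₃ + toℕ x) wraps)
      z<s z<s z<s gaps
    where
    wraps : (toℕ z + (suc o₃ + toℕ x)) % suc n ≡ toℕ x
    wraps = begin
      (toℕ z + (suc o₃ + toℕ x)) % suc n  ≡⟨ cong (_% suc n) (+-assoc (toℕ z) (suc o₃) (toℕ x)) ⟨
      (toℕ z + suc o₃ + toℕ x) % suc n    ≡⟨ cong (λ t → (t + toℕ x) % suc n) (trans (+-suc (toℕ z) o₃) z+o₃≡N) ⟩
      (suc n + toℕ x) % suc n             ≡⟨ cong (_% suc n) (+-comm (suc n) (toℕ x)) ⟩
      (toℕ x + suc n) % suc n             ≡⟨ [m+n]%n≡m%n (toℕ x) (suc n) ⟩
      toℕ x % suc n                       ≡⟨ m<n⇒m%n≡m (toℕ<n x) ⟩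
      toℕ x                               ∎
      where open ≡-Reasoning
    rearrange : ∀ a b c d → suc a + suc b + (suc c + d) ≡ suc (d + a) + suc b + suc c
    rearrange = solve-∀
    gaps : suc o₁ + suc o₂ + (suc o₃ + toℕ x) ≡ suc n
    gaps = begin
      suc o₁ + suc o₂ + (suc o₃ + toℕ x)  ≡⟨ rearrange o₁ o₂ o₃ (toℕ x) ⟩
      suc (toℕ x + o₁) + suc o₂ + suc o₃  ≡⟨ cong (λ t → t + suc o₂ + suc o₃) x+g₁≡y ⟩
      toℕ y + suc o₂ + suc o₃             ≡⟨ cong (_+ suc o₃) (trans (+-suc (toℕ y) o₂) y+g₂≡z) ⟩
      toℕ z + suc o₃                      ≡⟨ trans (+-suc (toℕ z) o₃) z+o₃≡N ⟩
      suc n                               ∎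
      where open ≡-Reasoning

  distinct-triple⇒¬IsOuterMV : ∀ {X b x y z} → 3 ≤ n → x ≢ y → y ≢ z → x ≢ z →
    (x , b) ∈ X → (y , b) ∈ X → (z , b) ∈ X → ¬ IsOuterMV G X
  distinct-triple⇒¬IsOuterMV {x = x} {y} {z} 3≤n x≢y y≢z x≢z x∈X y∈X z∈X
    with Fin.<-cmp x y | Fin.<-cmp y z | Fin.<-cmp x z
  ... | tri< x<y _ _ | tri< y<z _ _ | _ = sorted-triple⇒¬IsOuterMV 3≤n x<y y<z x∈X y∈X z∈X
  ... | tri> _ _ y<x | tri> _ _ z<y | _ = sorted-triple⇒¬IsOuterMV 3≤n z<y y<x z∈X y∈X x∈X
  ... | tri< _ _ _ | tri> _ _ z<y | tri< x<z _ _ = sorted-triple⇒¬IsOuterMV 3≤n x<z z<y x∈X z∈X y∈X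
  ... | tri< x<y _ _ | tri> _ _ _ | tri> _ _ z<x = sorted-triple⇒¬IsOuterMV 3≤n z<x x<y z∈X x∈X y∈X
  ... | tri> _ _ y<x | tri< _ _ _ | tri< x<z _ _ = sorted-triple⇒¬IsOuterMV 3≤n y<x x<z y∈X x∈X z∈X
  ... | tri> _ _ _ | tri< y<z _ _ | tri> _ _ z<x = sorted-triple⇒¬IsOuterMV 3≤n y<z z<x y∈X z∈X x∈X
  ... | tri≈ _ x≡y _ | _ | _ = contradiction x≡y x≢y
  ... | _ | tri≈ _ y≡z _ | _ = contradiction y≡z y≢z
  ... | _ | _ | tri≈ _ x≡z _ = contradiction x≡z x≢z

  row-length≤2 : ∀ {X b} → 3 ≤ n → IsOuterMV G X →
    ∀ {cs} → Unique cs → (∀ {a} → a ∈ cs → (a , b) ∈ X) → length cs ≤ 2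
  row-length≤2 _ _ {[]} _ _ = z≤n
  row-length≤2 _ _ {_ ∷ []} _ _ = s≤s z≤n
  row-length≤2 _ _ {_ ∷ _ ∷ []} _ _ = s≤s (s≤s z≤n)
  row-length≤2 3≤n outer {_ ∷ _ ∷ _ ∷ _} ((x≢y ∷ x≢z ∷ _) ∷ (y≢z ∷ _) ∷ _) in-row =
    ⊥-elim (distinct-triple⇒¬IsOuterMV 3≤n x≢y y≢z x≢z
      (in-row (here refl)) (in-row (there (here refl))) (in-row (there (there (here refl)))) outer)

large-torus-length≤2*m : ∀ {n m} → 3 ≤ n → (X : List (Fin (suc n) × Fin m)) → Unique X →
  IsOuterMV (Torus (suc n) m) X → length X ≤ 2 * m
large-torus-length≤2*m {n} {m} 3≤n X unique outer = begin
  length X                         ≡⟨ length≡∑-columns X ⟩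
  ∑[ b < m ] length (columns X b)  ≤⟨ ∑≤m*k (λ b → length (columns X b))
                                        (λ b → row-length≤2 3≤n outer (Unique-columns b unique) ∈-columns⁻) ⟩
  m * 2                            ≡⟨ *-comm m 2 ⟩
  2 * m                            ∎
  where open ≤-Reasoning

C₃-adjacent : ∀ {a c : Fin 3} → a ≢ c → CycleAdj 3 a c
C₃-adjacent {0F} {0F} a≢c = contradiction refl a≢c
C₃-adjacent {0F} {1F} _ = inj₁ refl
C₃-adjacent {0F} {2F} _ = inj₂ refl
C₃-adjacent {1F} {0F} _ = inj₂ refl
C₃-adjacent {1F} {1F} a≢c = contradiction refl a≢c
C₃-adjacent {1F} {2F} _ = inj₁ refl
C₃-adjacent {2F} {0F} _ = inj₁ refl
C₃-adjacent {2F} {1F} _ = inj₂ refl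
C₃-adjacent {2F} {2F} a≢c = contradiction refl a≢c

full-row⇒other-rows-empty : ∀ {X b b'} → Unique X → IsOuterMV (Torus 3 3) X →
  3 ≤ length (columns X b) → b ≢ b' → length (columns X b') ≡ 0
full-row⇒other-rows-empty {X} {b} {b'} unique outer full b≢b' with columns X b' in row-b'
... | [] = refl
... | a ∷ _ = contradiction outer
  (corner⇒¬IsOuterMV (inj₁ (toℕ-fromℕ< _)) (C₃-adjacent b≢b') (⊕-≢-⊕ a z<s (s≤s z<s)) b≢b'
    (in-row-b a) (in-row-b (next a)) (∈-columns⁻ (subst (a ∈_) (sym row-b') (here refl))))
  where
  in-row-b : ∀ c → (c , b) ∈ X
  in-row-b c = ∈-columns⁻ (Unique∧k≤length⇒∈ (Unique-columns b unique) full c)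

∑₃≤6 : (r : Fin 3 → ℕ) → (∀ b → r b ≤ 3) → (∀ {b b'} → 3 ≤ r b → b ≢ b' → r b' ≡ 0) →
  ∑[ b < 3 ] r b ≤ 6
∑₃≤6 r r≤3 alone with 3 ≤? r 0F | 3 ≤? r 1F | 3 ≤? r 2F
... | yes full | _ | _ rewrite alone {0F} {1F} full (λ ()) | alone {0F} {2F} full (λ ()) =
  m≤n⇒m≤o+n 3 (+-mono-≤ (r≤3 0F) z≤n)
... | _ | yes full | _ rewrite alone {1F} {0F} full (λ ()) | alone {1F} {2F} full (λ ()) =
  m≤n⇒m≤o+n 3 (+-mono-≤ (r≤3 1F) z≤n)
... | _ | _ | yes full rewrite alone {2F} {0F} full (λ ()) | alone {2F} {1F} full (λ ()) =
  m≤n⇒m≤o+n 3 (+-mono-≤ (r≤3 2F) z≤n)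
... | no 3≰r₀ | no 3≰r₁ | no 3≰r₂ = +-mono-≤ (≤2 3≰r₀) (+-mono-≤ (≤2 3≰r₁) (+-mono-≤ (≤2 3≰r₂) z≤n))
  where
  ≤2 : ∀ {x} → ¬ 3 ≤ x → x ≤ 2
  ≤2 3≰x = s≤s⁻¹ (≰⇒> 3≰x)

C₃□C₃-length≤6 : (X : List (Fin 3 × Fin 3)) → Unique X → IsOuterMV (Torus 3 3) X → length X ≤ 6
C₃□C₃-length≤6 X unique outer = begin
  length X                         ≡⟨ length≡∑-columns X ⟩
  ∑[ b < 3 ] length (columns X b)  ≤⟨ ∑₃≤6 (λ b → length (columns X b))
                                        (λ b → Unique⇒length≤ (Unique-columns b unique))
                                        (full-row⇒other-rows-empty unique outer) ⟩
  6                                ∎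
  where open ≤-Reasoning

corollary4p8 : (n m : ℕ) → 3 ≤ m → m ≤ n →
    (X : List (Graph.V (Torus n m))) → Unique X → IsOuterMV (Torus n m) X →
    length X ≤ 2 * m
corollary4p8 n m 3≤m m≤n X unique outer with ≤-trans 3≤m m≤n
... | s≤s (s≤s (s≤s (z≤n {suc _}))) = large-torus-length≤2*m (s≤s (s≤s (s≤s z≤n))) X unique outer
... | s≤s (s≤s (s≤s (z≤n {zero}))) with ≤-antisym m≤n 3≤m
...   | refl = C₃□C₃-length≤6 X unique outer
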